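{- Let $n>2$ and $k<n$ be positive integers, and let $a_1,\dots,a_k$ be positive integers with $\prod_{i=1}^k a_i\geq\sum_{i=1}^k a_i+(n-k)$. Let $a'_1,\dots,a'_k$ be integers with $a'_j\geq a_j$ for all $1\leq j\leq k$ and $(a'_1,\dots,a'_k)\neq(a_1,\dots,a_k)$. Then $\prod_{i=1}^k a'_i>\sum_{i=1}^k a'_i+(n-k)$; in particular the sequence $(a'_1,\dots,a'_k,1,\dots,1)\in\mathbb N^n$ does not satisfy $\prod_{i=1}^n a'_i=\sum_{i=1}^n a'_i$.
   Context: $\mathbb N$ denotes the positive integers. -}

module Defs where

open import Data.Nat using (ℕ; zero; suc; _<_)
open import Data.Fin using (Fin; zero; suc; toℕ; fromℕ<)
open import Data.Integer using (ℤ; _+_; _*_; 1ℤ; 0ℤ)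
open import Relation.Nullary using (yes; no)
open import Data.Nat.Properties using (_<?_)

∑ : (m : ℕ) → (Fin m → ℤ) → ℤ
∑ zero    f = 0ℤ
∑ (suc m) f = f zero + ∑ m (λ i → f (suc i))

∏ : (m : ℕ) → (Fin m → ℤ) → ℤ
∏ zero    f = 1ℤ
∏ (suc m) f = f zero * ∏ m (λ i → f (suc i))

padOnes : (k n : ℕ) → (Fin k → ℤ) → Fin n → ℤ
padOnes k n b i with toℕ i <? k
... | yes p = b (fromℕ< p)
... | no _  = 1ℤ

-- Write E_c(x) = c ∏ x − ∑ x; the theorem is about E_1. Splitting off the first coordinate,
-- E_c(x₀, X) = E_{c x₀}(X) − x₀ = x₀ (c ∏ X − 1) − ∑ X. So raising x₀ raises E_c by a
-- multiple of c ∏ X − 1 ≥ 0, and raising X raises E_{c x₀}(X) by induction, with the weight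
-- c absorbing the fixed coordinates. When E_c(x) > 0 the multiplier c ∏ X − 1 is positive,
-- so E_c strictly increases at the first coordinate that changes. The hypothesis says
-- E_1(a) ≥ n − k ≥ 1, hence E_1(a′) > n − k; padding with ones keeps ∏ and adds n − k to ∑.
module Submission where

open import Defs
open import Data.Nat using (ℕ; _∸_) renaming (_<_ to _<ℕ_; _>_ to _>ℕ_)
open import Data.Fin using (Fin)
open import Data.Integer using (ℤ; +_; _+_; _≤_; _<_)
open import Data.Product using (_×_)
open import Relation.Binary.PropositionalEquality using (_≡_)
open import Relation.Nullary using (¬_)

open import Data.Nat as ℕ using (zero; suc; z≤n; s≤s)
import Data.Nat.Properties as ℕ
open import Data.Fin using (zero; suc; toℕ; fromℕ<)
open import Data.Integer using (_-_; _*_; -_; 0ℤ; 1ℤ; +≤+; +<+; nonNegative; positive)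
open import Data.Integer.Properties
open import Data.Integer.Tactic.RingSolver using (solve-∀)
open import Data.Vec.Functional using (head; tail)
open import Data.Product using (_,_)
open import Data.Empty using (⊥-elim)
open import Function using (_∘_)
open import Relation.Nullary using (Dec; yes; no)
open import Relation.Binary.PropositionalEquality using (refl; sym; trans; cong; cong₂; module ≡-Reasoning)

private
  variable
    k : ℕ
    i j : ℤ
    x : Fin k → ℤ

i+j≤k⇒j≤k-i : ∀ {i j k} → i + j ≤ k → j ≤ k - i
i+j≤k⇒j≤k-i {i} {j} {k} i+j≤k = ≤-trans (≤-reflexive (sym (cancel i j))) (+-monoˡ-≤ (- i) i+j≤k)
  where
  cancel : ∀ i j → i + j - i ≡ j
  cancel = solve-∀

j<k-i⇒i+j<k : ∀ {i j k} → j < k - i → i + j < k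
j<k-i⇒i+j<k {i} {j} {k} j<k-i = <-≤-trans (+-monoʳ-< i j<k-i) (≤-reflexive (cancel i k))
  where
  cancel : ∀ i k → i + (k - i) ≡ k
  cancel = solve-∀

1≤i*j : 1ℤ ≤ i → 1ℤ ≤ j → 1ℤ ≤ i * j
1≤i*j (+≤+ (s≤s _)) (+≤+ (s≤s _)) = +≤+ (s≤s z≤n)

1≤∏ : (∀ i → 1ℤ ≤ x i) → 1ℤ ≤ ∏ k x
1≤∏ {zero}  _   = ≤-refl
1≤∏ {suc k} 1≤x = 1≤i*j (1≤x zero) (1≤∏ (1≤x ∘ suc))

0≤∑ : (∀ i → 0ℤ ≤ x i) → 0ℤ ≤ ∑ k x
0≤∑ {zero}  _   = ≤-refl
0≤∑ {suc k} 0≤x = +-mono-≤ (0≤x zero) (0≤∑ (0≤x ∘ suc))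

excess : ℤ → (Fin k → ℤ) → ℤ
excess {k} c x = c * ∏ k x - ∑ k x

excess-head : ∀ c (x : Fin (suc k) → ℤ) → excess c x ≡ excess (c * head x) (tail x) - head x
excess-head {k} c x = regroup c (head x) (∏ k (tail x)) (∑ k (tail x))
  where
  regroup : ∀ c t P S → c * (t * P) - (t + S) ≡ (c * t) * P - S - t
  regroup = solve-∀

excess-linear : ∀ c t (x : Fin k → ℤ) → excess (c * t) x - t ≡ t * (c * ∏ k x - 1ℤ) - ∑ k x
excess-linear {k} c t x = regroup c t (∏ k x) (∑ k x)
  where
  regroup : ∀ c t P S → (c * t) * P - S - t ≡ t * (c * P - 1ℤ) - S
  regroup = solve-∀

excess-linear-mono-≤ : ∀ c (x : Fin k → ℤ) → 0ℤ ≤ c * ∏ k x - 1ℤ →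
                       i ≤ j → excess (c * i) x - i ≤ excess (c * j) x - j
excess-linear-mono-≤ {k} {i} {j} c x 0≤m i≤j = begin
  excess (c * i) x - i          ≡⟨ excess-linear c i x ⟩
  i * m - ∑ k x                 ≤⟨ +-monoˡ-≤ (- ∑ k x) (*-monoʳ-≤-nonNeg m ⦃ nonNegative 0≤m ⦄ i≤j) ⟩
  j * m - ∑ k x                 ≡⟨ excess-linear c j x ⟨
  excess (c * j) x - j          ∎
  where
  open ≤-Reasoning
  m = c * ∏ k x - 1ℤ

excess-linear-mono-< : ∀ c (x : Fin k → ℤ) → 0ℤ < c * ∏ k x - 1ℤ →
                       i < j → excess (c * i) x - i < excess (c * j) x - j
excess-linear-mono-< {k} {i} {j} c x 0<m i<j = begin-strict
  excess (c * i) x - i          ≡⟨ excess-linear c i x ⟩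
  i * m - ∑ k x                 <⟨ +-monoˡ-< (- ∑ k x) (*-monoʳ-<-pos m ⦃ positive 0<m ⦄ i<j) ⟩
  j * m - ∑ k x                 ≡⟨ excess-linear c j x ⟨
  excess (c * j) x - j          ∎
  where
  open ≤-Reasoning
  m = c * ∏ k x - 1ℤ

excess-mono-≤ : ∀ {k c} {x y : Fin k → ℤ} → 1ℤ ≤ c → (∀ i → 1ℤ ≤ x i) → (∀ i → x i ≤ y i) →
                excess c x ≤ excess c y
excess-mono-≤ {zero}              _   _   _   = ≤-refl
excess-mono-≤ {suc k} {c} {x} {y} 1≤c 1≤x x≤y = begin
  excess c x                            ≡⟨ excess-head c x ⟩
  excess (c * x₀) (tail x) - x₀         ≤⟨ excess-linear-mono-≤ c (tail x) 0≤m (x≤y zero) ⟩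
  excess (c * y₀) (tail x) - y₀         ≤⟨ +-monoˡ-≤ (- y₀) (excess-mono-≤ 1≤cy₀ (1≤x ∘ suc) (x≤y ∘ suc)) ⟩
  excess (c * y₀) (tail y) - y₀         ≡⟨ excess-head c y ⟨
  excess c y                            ∎
  where
  open ≤-Reasoning
  x₀ = head x
  y₀ = head y
  0≤m : 0ℤ ≤ c * ∏ k (tail x) - 1ℤ
  0≤m = i≤j⇒0≤j-i (1≤i*j 1≤c (1≤∏ (1≤x ∘ suc)))
  1≤cy₀ : 1ℤ ≤ c * y₀
  1≤cy₀ = 1≤i*j 1≤c (≤-trans (1≤x zero) (x≤y zero))

0<excess⇒0<excess-tail : ∀ c (x : Fin (suc k) → ℤ) → 0ℤ ≤ head x →
                         0ℤ < excess c x → 0ℤ < excess (c * head x) (tail x)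
0<excess⇒0<excess-tail c x 0≤x₀ 0<E = begin-strict
  0ℤ                                    <⟨ 0<E ⟩
  excess c x                            ≡⟨ excess-head c x ⟩
  excess (c * head x) (tail x) - head x ≤⟨ i-j≤i _ (head x) ⦃ nonNegative 0≤x₀ ⦄ ⟩
  excess (c * head x) (tail x)          ∎
  where open ≤-Reasoning

0<excess⇒0<c*∏tail-1 : ∀ c (x : Fin (suc k) → ℤ) → (∀ i → 0ℤ ≤ x i) →
                       0ℤ < excess c x → 0ℤ < c * ∏ k (tail x) - 1ℤ
0<excess⇒0<c*∏tail-1 {k} c x 0≤x 0<E = *-cancelˡ-<-nonNeg x₀ ⦃ nonNegative (0≤x zero) ⦄ (begin-strict
  x₀ * 0ℤ                               ≡⟨ *-zeroʳ x₀ ⟩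
  0ℤ                                    <⟨ 0<E ⟩
  excess c x                            ≡⟨ excess-head c x ⟩
  excess (c * x₀) (tail x) - x₀         ≡⟨ excess-linear c x₀ (tail x) ⟩
  x₀ * m - ∑ k (tail x)                 ≤⟨ i-j≤i _ _ ⦃ nonNegative (0≤∑ (0≤x ∘ suc)) ⦄ ⟩
  x₀ * m                                ∎)
  where
  open ≤-Reasoning
  x₀ = head x
  m = c * ∏ k (tail x) - 1ℤ

excess-mono-< : ∀ {k c} {x y : Fin k → ℤ} → 1ℤ ≤ c → (∀ i → 1ℤ ≤ x i) → (∀ i → x i ≤ y i) →
                0ℤ < excess c x → ¬ (∀ i → y i ≡ x i) → excess c x < excess c y
excess-mono-< {zero}              _   _   _   _   y≢x = ⊥-elim (y≢x λ ())
excess-mono-< {suc k} {c} {x} {y} 1≤c 1≤x x≤y 0<E y≢x with head x ≟ head y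
... | no x₀≢y₀ = begin-strict
  excess c x                            ≡⟨ excess-head c x ⟩
  excess (c * x₀) (tail x) - x₀         <⟨ excess-linear-mono-< c (tail x) 0<m x₀<y₀ ⟩
  excess (c * y₀) (tail x) - y₀         ≤⟨ +-monoˡ-≤ (- y₀) (excess-mono-≤ 1≤cy₀ (1≤x ∘ suc) (x≤y ∘ suc)) ⟩
  excess (c * y₀) (tail y) - y₀         ≡⟨ excess-head c y ⟨
  excess c y                            ∎
  where
  open ≤-Reasoning
  x₀ = head x
  y₀ = head y
  0<m : 0ℤ < c * ∏ k (tail x) - 1ℤ
  0<m = 0<excess⇒0<c*∏tail-1 c x (λ i → ≤-trans (+≤+ z≤n) (1≤x i)) 0<E
  x₀<y₀ : x₀ < y₀
  x₀<y₀ = ≤∧≢⇒< (x≤y zero) x₀≢y₀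
  1≤cy₀ : 1ℤ ≤ c * y₀
  1≤cy₀ = 1≤i*j 1≤c (≤-trans (1≤x zero) (x≤y zero))
... | yes x₀≡y₀ = begin-strict
  excess c x                            ≡⟨ excess-head c x ⟩
  excess (c * x₀) (tail x) - x₀         <⟨ +-monoˡ-< (- x₀) tail-step ⟩
  excess (c * x₀) (tail y) - x₀         ≡⟨ cong (λ t → excess (c * t) (tail y) - t) x₀≡y₀ ⟩
  excess (c * y₀) (tail y) - y₀         ≡⟨ excess-head c y ⟨
  excess c y                            ∎
  where
  open ≤-Reasoning
  x₀ = head x
  y₀ = head y
  tail-step : excess (c * x₀) (tail x) < excess (c * x₀) (tail y)
  tail-step = excess-mono-< (1≤i*j 1≤c (1≤x zero)) (1≤x ∘ suc) (x≤y ∘ suc)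
                (0<excess⇒0<excess-tail c x (≤-trans (+≤+ z≤n) (1≤x zero)) 0<E)
                (λ tail-eq → y≢x λ { zero → sym x₀≡y₀ ; (suc i) → tail-eq i })

∏-cong : ∀ n {f g : Fin n → ℤ} → (∀ i → f i ≡ g i) → ∏ n f ≡ ∏ n g
∏-cong zero    _   = refl
∏-cong (suc n) f≗g = cong₂ _*_ (f≗g zero) (∏-cong n (f≗g ∘ suc))

∑-cong : ∀ n {f g : Fin n → ℤ} → (∀ i → f i ≡ g i) → ∑ n f ≡ ∑ n g
∑-cong zero    _   = refl
∑-cong (suc n) f≗g = cong₂ _+_ (f≗g zero) (∑-cong n (f≗g ∘ suc))

∏-const-1 : ∀ n → ∏ n (λ _ → 1ℤ) ≡ 1ℤ
∏-const-1 zero    = refl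
∏-const-1 (suc n) = trans (*-identityˡ _) (∏-const-1 n)

∑-const-1 : ∀ n → ∑ n (λ _ → 1ℤ) ≡ + n
∑-const-1 zero    = refl
∑-const-1 (suc n) = cong (_+_ 1ℤ) (∑-const-1 n)

module _ {n} (b : Fin k → ℤ) (i : Fin n) where

  padOnes-< : (i<k : toℕ i <ℕ k) → padOnes k n b i ≡ b (fromℕ< i<k)
  padOnes-< i<k with toℕ i ℕ.<? k
  ... | yes _   = refl
  ... | no  i≮k = ⊥-elim (i≮k i<k)

  padOnes-≮ : ¬ (toℕ i <ℕ k) → padOnes k n b i ≡ 1ℤ
  padOnes-≮ i≮k with toℕ i ℕ.<? k
  ... | yes i<k = ⊥-elim (i≮k i<k)
  ... | no  _   = refl

padOnes-suc : ∀ {n} (b : Fin (suc k) → ℤ) (i : Fin n) →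
              padOnes (suc k) (suc n) b (suc i) ≡ padOnes k n (tail b) i
padOnes-suc {k} b i = by-cases (toℕ i ℕ.<? k)
  where
  by-cases : Dec (toℕ i <ℕ k) → padOnes (suc k) _ b (suc i) ≡ padOnes k _ (tail b) i
  by-cases (yes i<k) = trans (padOnes-< b (suc i) (s≤s i<k)) (sym (padOnes-< (tail b) i i<k))
  by-cases (no  i≮k) = trans (padOnes-≮ b (suc i) (i≮k ∘ ℕ.s≤s⁻¹)) (sym (padOnes-≮ (tail b) i i≮k))

∏-padOnes : ∀ n (b : Fin k → ℤ) → k ℕ.≤ n → ∏ n (padOnes k n b) ≡ ∏ k b
∏-padOnes {zero}  n       b _         = trans (∏-cong n (λ i → padOnes-≮ b i λ ())) (∏-const-1 n)
∏-padOnes {suc k} (suc n) b (s≤s k≤n) =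
  cong (head b *_) (trans (∏-cong n (padOnes-suc b)) (∏-padOnes n (tail b) k≤n))

∑-padOnes : ∀ n (b : Fin k → ℤ) → k ℕ.≤ n → ∑ n (padOnes k n b) ≡ ∑ k b + + (n ∸ k)
∑-padOnes {zero}  n       b _         = trans (∑-cong n (λ i → padOnes-≮ b i λ ())) (∑-const-1 n)
∑-padOnes {suc k} (suc n) b (s≤s k≤n) = trans
  (cong (_+_ (head b)) (trans (∑-cong n (padOnes-suc b)) (∑-padOnes n (tail b) k≤n)))
  (sym (+-assoc (head b) _ _))

lemma3p3 : (n k : ℕ) → n >ℕ 2 → 0 <ℕ k → k <ℕ n →
    (a : Fin k → ℕ) → (∀ i → 0 <ℕ a i) →
    ∑ k (λ i → + a i) + + (n ∸ k) ≤ ∏ k (λ i → + a i) →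
    (a′ : Fin k → ℤ) → (∀ j → + a j ≤ a′ j) → ¬ (∀ j → a′ j ≡ + a j) →
    (∑ k a′ + + (n ∸ k) < ∏ k a′)
      × ¬ (∏ n (padOnes k n a′) ≡ ∑ n (padOnes k n a′))
lemma3p3 n k _ _ k<n a 0<a a-bound a′ a≤a′ a′≢a = a′-bound , ∏≢∑
  where
  d = + (n ∸ k)
  d≤excess-a : d ≤ excess 1ℤ (λ i → + a i)
  d≤excess-a = i+j≤k⇒j≤k-i (≤-trans a-bound (≤-reflexive (sym (*-identityˡ _))))
  excess-a<excess-a′ : excess 1ℤ (λ i → + a i) < excess 1ℤ a′
  excess-a<excess-a′ = excess-mono-< ≤-refl (+≤+ ∘ 0<a) a≤a′
    (<-≤-trans (+<+ (ℕ.m<n⇒0<n∸m k<n)) d≤excess-a) a′≢a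
  a′-bound : ∑ k a′ + d < ∏ k a′
  a′-bound = <-≤-trans (j<k-i⇒i+j<k (≤-<-trans d≤excess-a excess-a<excess-a′)) (≤-reflexive (*-identityˡ _))
  ∏≢∑ : ¬ (∏ n (padOnes k n a′) ≡ ∑ n (padOnes k n a′))
  ∏≢∑ ∏≡∑ = <⇒≢ a′-bound (begin
    ∑ k a′ + d                ≡⟨ ∑-padOnes n a′ (ℕ.<⇒≤ k<n) ⟨
    ∑ n (padOnes k n a′)      ≡⟨ ∏≡∑ ⟨
    ∏ n (padOnes k n a′)      ≡⟨ ∏-padOnes n a′ (ℕ.<⇒≤ k<n) ⟩
    ∏ k a′                    ∎)
    where open ≡-Reasoning
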